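{- Let $n\in\mathbb{N}$ and $1\le i\le n$. Then $$\sum_{\substack{(a_1,\ldots,a_n)\in\mathcal{A}_n\\ a_i>0}}c_{(a_1,\ldots,a_n)}=(n-i+1)(n-1)!.$$
   Context: For $n\in\mathbb{N}$ and indeterminates $x_1,\ldots,x_n$, let $p_n=x_1(x_1+x_2)\cdots(x_1+x_2+\cdots+x_n)$. Let $\mathbb{N}_0=\mathbb{N}\cup\{0\}$ and $\mathcal{A}_n=\{(a_1,\ldots,a_n)\in\mathbb{N}_0^n : \sum_{i=k+1}^n a_i\le n-k \text{ for all } 1\le k\le n-1,\ \sum_{i=1}^n a_i=n\}$; these are exactly the exponent vectors of the monomials of $p_n$. For $a\in\mathcal{A}_n$, $c_a$ denotes the coefficient of $x_1^{a_1}\cdots x_n^{a_n}$ in the expansion of $p_n$. -}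

module Defs where

open import Data.Nat using (ℕ; zero; suc; _+_; _*_; _∸_; _≤_; _<?_; _≤?_; _≟_)
open import Data.Nat.ListAction using (sum)

open import Data.Fin using (Fin; toℕ; _≟_)
open import Data.Fin.Properties using () renaming (_≟_ to _≟F_)
open import Data.Vec using (Vec; []; _∷_; tabulate; zipWith; replicate; toList; lookup)
open import Data.Vec.Properties using (≡-dec)
open import Data.List using (List; []; _∷_; map; concatMap; filter; foldr; drop; upTo; _++_)
open import Data.List.Relation.Unary.All using (All; all?)
open import Data.Product using (_×_; _,_)
open import Relation.Nullary using (Dec; yes; no; _×-dec_)
open import Relation.Nullary.Decidable using (does)
open import Relation.Binary.PropositionalEquality using (_≡_)
open import Data.Bool using (if_then_else_)

-- Polynomials in n variables x_1..x_n with ℕ coefficients, represented as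
-- formal (unnormalised) sums of terms (coefficient , exponent vector).
Poly : ℕ → Set
Poly n = List (ℕ × Vec ℕ n)

_⊗_ : ∀ {n} → Poly n → Poly n → Poly n
P ⊗ Q = concatMap (λ { (c , e) → map (λ { (d , f) → (c * d , zipWith _+_ e f) }) Q }) P

one : ∀ {n} → Poly n
one {n} = (1 , replicate n 0) ∷ []

var : ∀ {n} → Fin n → Poly n
var {n} j = (1 , tabulate (λ m → if does (m ≟F j) then 1 else 0)) ∷ []

finList : (n : ℕ) → List (Fin n)
finList n = Data.Vec.toList (Data.Vec.allFin n)

linForm : ∀ {n} → Fin n → Poly n
linForm {n} k = concatMap (λ j → if does (toℕ j ≤? toℕ k) then var j else []) (finList n)

-- p_n = x_1 (x_1 + x_2) ... (x_1 + ... + x_n)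
p : (n : ℕ) → Poly n
p n = foldr (λ k acc → linForm k ⊗ acc) one (finList n)

coeff : ∀ {n} → Poly n → Vec ℕ n → ℕ
coeff P a = sum (map (λ { (c , e) → if does (≡-dec Data.Nat._≟_ e a) then c else 0 }) P)

boundedVecs : (b m : ℕ) → List (Vec ℕ m)
boundedVecs b zero = [] ∷ []
boundedVecs b (suc m) = concatMap (λ x → map (x ∷_) (boundedVecs b m)) (upTo (suc b))

-- membership condition for 𝒜_n:
-- sum_{i=k+1}^n a_i ≤ n - k for 1 ≤ k ≤ n-1, and sum_{i=1}^n a_i = n
InA : (n : ℕ) → Vec ℕ n → Set
InA n a = All (λ k → sum (drop k (toList a)) ≤ n ∸ k) (Data.List.map suc (upTo (n ∸ 1)))
          × sum (toList a) ≡ n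

InA? : (n : ℕ) → (a : Vec ℕ n) → Dec (InA n a)
InA? n a = all? (λ k → sum (drop k (toList a)) ≤? n ∸ k) (Data.List.map suc (upTo (n ∸ 1)))
           ×-dec (sum (toList a) Data.Nat.≟ n)

-- 𝒜_n as an explicit list (entries of any a ∈ 𝒜_n are ≤ n since they sum to n)
𝒜 : (n : ℕ) → List (Vec ℕ n)
𝒜 n = filter (InA? n) (boundedVecs n n)

-- sum of c_a over a ∈ 𝒜_n with a_i > 0  (i : Fin n is 0-based, i.e. paper's i = toℕ i + 1)
sumPos : (n : ℕ) → Fin n → ℕ
sumPos n i = sum (map (coeff (p n)) (filter (λ a → 0 <? lookup a i) (𝒜 n)))

-- Σ_{a ∈ 𝒜_n, a_i > 0} c_a = p_n(1,…,1) − p_n(1,…,1,0,1,…,1) with the 0 in position i: every exponent of the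
-- expanded product lies in 𝒜_n, and 𝒜_n lists each vector once. Both evaluations are coefficient sums over the
-- exponents selected by a predicate b with b (e + f) = b e ∧ b f, so they are multiplicative and factor over the
-- linear forms x_1 + ⋯ + x_k. At (1,…,1) these take the values 1, 2, …, n; with x_i = 0 they take
-- 1, …, i−1, i−1, i, …, n−1. Hence the sum is n! − (i−1)(n−1)! = (n−i+1)(n−1)!.

module Submission where

open import Defs
open import Data.Bool using (Bool; true; false; if_then_else_; not; _∧_)
open import Data.Bool.Properties using (∧-identityʳ; if-float; if-cong; if-eta)
open import Data.Fin using (Fin; zero; suc; toℕ)
open import Data.Fin.Properties using (toℕ≤pred[n]) renaming (_≟_ to _≟F_)
open import Data.List using (List; []; _∷_; map; concatMap; filter; foldr; drop; upTo; downFrom; _++_)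
open import Data.List.Properties
  using (map-∘; map-cong; map-cong-local; map-++; map-upTo; map-applyUpTo; reverse-upTo)
open import Data.List.Relation.Binary.Permutation.Propositional using (_↭_; ↭-sym)
import Data.List.Relation.Binary.Permutation.Propositional.Properties as ↭
open import Data.List.Relation.Unary.All as All using (All; []; _∷_)
open import Data.List.Relation.Unary.All.Properties using (map⁺; concat⁺)
open import Data.Nat
  using (ℕ; zero; suc; _+_; _*_; _∸_; _!; _≤_; _<_; _≤′_; ≤′-refl; ≤′-step; z≤n; s≤s; _≤?_; _<?_; _≟_)
open import Data.Nat.ListAction using (sum; product)
open import Data.Nat.ListAction.Properties using (sum-++; product-↭)
open import Data.Nat.Properties
import Algebra.Properties.CommutativeSemigroup as CommSemigroupProperties
open CommSemigroupProperties +-commutativeSemigroup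
  using () renaming (interchange to [m+n]+[o+p]≡[m+o]+[n+p])
open CommSemigroupProperties *-commutativeSemigroup
  using () renaming (x∙yz≈y∙xz to m*[n*o]≡n*[m*o])
open import Data.Product using (_×_; _,_; proj₂)
open import Data.Vec as Vec using (Vec; []; _∷_; tabulate; zipWith; replicate; toList; lookup)
open import Data.Vec.Properties
  using (≡-dec; lookup-zipWith; lookup-replicate; lookup∘tabulate; tabulate-∘; tabulate-allFin; map-const; toList-map)
open import Function using (_∘_; id)
open import Relation.Nullary using (Dec; does; yes; no; contradiction)
open import Relation.Nullary.Decidable using (dec-true; dec-false)
open import Relation.Unary using (Decidable)
open import Relation.Binary.PropositionalEquality

𝟙 : Bool → ℕ
𝟙 b = if b then 1 else 0

private variable
  A B : Set

sum-map-zero : (xs : List A) → sum (map (λ _ → 0) xs) ≡ 0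
sum-map-zero []       = refl
sum-map-zero (_ ∷ xs) = sum-map-zero xs

sum-map-+ : (f g : A → ℕ) (xs : List A) →
            sum (map (λ x → f x + g x) xs) ≡ sum (map f xs) + sum (map g xs)
sum-map-+ f g []       = refl
sum-map-+ f g (x ∷ xs) = begin
  f x + g x + sum (map (λ x → f x + g x) xs)     ≡⟨ cong (f x + g x +_) (sum-map-+ f g xs) ⟩
  f x + g x + (sum (map f xs) + sum (map g xs))  ≡⟨ [m+n]+[o+p]≡[m+o]+[n+p] (f x) (g x) _ _ ⟩
  f x + sum (map f xs) + (g x + sum (map g xs))  ∎
  where open ≡-Reasoning

sum-map-*ˡ : (k : ℕ) (f : A → ℕ) (xs : List A) → sum (map (λ x → k * f x) xs) ≡ k * sum (map f xs)
sum-map-*ˡ k f []       = sym (*-zeroʳ k)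
sum-map-*ˡ k f (x ∷ xs) = trans (cong (k * f x +_) (sum-map-*ˡ k f xs)) (sym (*-distribˡ-+ k (f x) _))

sum-map-if : (b : Bool) (f : A → ℕ) (xs : List A) →
             sum (map (λ x → if b then f x else 0) xs) ≡ (if b then sum (map f xs) else 0)
sum-map-if true  f xs = refl
sum-map-if false f xs = sum-map-zero xs

sum-map-filter : {P : A → Set} (P? : Decidable P) (f : A → ℕ) (xs : List A) →
                 sum (map f (filter P? xs)) ≡ sum (map (λ x → if does (P? x) then f x else 0) xs)
sum-map-filter P? f []       = refl
sum-map-filter P? f (x ∷ xs) with does (P? x)
... | true  = cong (f x +_) (sum-map-filter P? f xs)
... | false = sum-map-filter P? f xs

sum-map-concatMap : (f : B → ℕ) (g : A → List B) (xs : List A) →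
                    sum (map f (concatMap g xs)) ≡ sum (map (λ x → sum (map f (g x))) xs)
sum-map-concatMap f g []       = refl
sum-map-concatMap f g (x ∷ xs) = begin
  sum (map f (g x ++ concatMap g xs))                  ≡⟨ cong sum (map-++ f (g x) _) ⟩
  sum (map f (g x) ++ map f (concatMap g xs))          ≡⟨ sum-++ (map f (g x)) _ ⟩
  sum (map f (g x)) + sum (map f (concatMap g xs))     ≡⟨ cong (sum (map f (g x)) +_) (sum-map-concatMap f g xs) ⟩
  sum (map f (g x)) + sum (map (λ x → sum (map f (g x))) xs) ∎
  where open ≡-Reasoning

sum-map-comm : (f : A → B → ℕ) (xs : List A) (ys : List B) →
               sum (map (λ x → sum (map (f x) ys)) xs) ≡ sum (map (λ y → sum (map (λ x → f x y) xs)) ys)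
sum-map-comm f []       ys = sym (sum-map-zero ys)
sum-map-comm f (x ∷ xs) ys = trans (cong (sum (map (f x) ys) +_) (sum-map-comm f xs ys))
                                   (sym (sum-map-+ (f x) (λ y → sum (map (λ x → f x y) xs)) ys))

finList-suc : ∀ n → finList (suc n) ≡ zero ∷ map suc (finList n)
finList-suc n = cong (zero ∷_) (trans (cong toList (tabulate-∘ suc id)) (toList-map suc (Vec.allFin n)))

sum-finList-suc : ∀ n (f : Fin (suc n) → ℕ) →
                  sum (map f (finList (suc n))) ≡ f zero + sum (map (f ∘ suc) (finList n))
sum-finList-suc n f = begin
  sum (map f (finList (suc n)))             ≡⟨ cong (sum ∘ map f) (finList-suc n) ⟩
  f zero + sum (map f (map suc (finList n))) ≡⟨ cong (λ xs → f zero + sum xs) (map-∘ (finList n)) ⟨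
  f zero + sum (map (f ∘ suc) (finList n))   ∎
  where open ≡-Reasoning

map-toℕ-finList : ∀ n → map toℕ (finList n) ≡ upTo n
map-toℕ-finList zero    = refl
map-toℕ-finList (suc n) = begin
  map toℕ (finList (suc n))        ≡⟨ cong (map toℕ) (finList-suc n) ⟩
  0 ∷ map toℕ (map suc (finList n)) ≡⟨ cong (0 ∷_) (sym (map-∘ (finList n))) ⟩
  0 ∷ map (suc ∘ toℕ) (finList n)   ≡⟨ cong (0 ∷_) (map-∘ (finList n)) ⟩
  0 ∷ map suc (map toℕ (finList n)) ≡⟨ cong (λ xs → 0 ∷ map suc xs) (map-toℕ-finList n) ⟩
  0 ∷ map suc (upTo n)              ≡⟨ cong (0 ∷_) (map-upTo suc n) ⟩
  upTo (suc n)                      ∎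
  where open ≡-Reasoning

product-finList : ∀ n (f : ℕ → ℕ) → product (map (f ∘ toℕ) (finList n)) ≡ product (map f (downFrom n))
product-finList n f = begin
  product (map (f ∘ toℕ) (finList n))   ≡⟨ cong product (map-∘ (finList n)) ⟩
  product (map f (map toℕ (finList n))) ≡⟨ cong (product ∘ map f) (map-toℕ-finList n) ⟩
  product (map f (upTo n))              ≡⟨ product-↭ (↭.map⁺ f upTo↭downFrom) ⟩
  product (map f (downFrom n))          ∎
  where
  open ≡-Reasoning
  upTo↭downFrom : upTo n ↭ downFrom n
  upTo↭downFrom = subst (upTo n ↭_) (reverse-upTo n) (↭-sym (↭.↭-reverse (upTo n)))

sum-map-upTo-suc : ∀ n (f : ℕ → ℕ) → sum (map f (upTo (suc n))) ≡ f 0 + sum (map (f ∘ suc) (upTo n))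
sum-map-upTo-suc n f =
  cong (λ xs → f 0 + sum xs) (trans (map-applyUpTo suc f n) (sym (map-upTo (f ∘ suc) n)))

≤?-suc : ∀ m n → does (suc m ≤? suc n) ≡ does (m ≤? n)
≤?-suc zero    n = refl
≤?-suc (suc m) n = refl

count-≥ : ∀ n t → sum (map (λ k → 𝟙 (does (t ≤? toℕ k))) (finList n)) ≡ n ∸ t
count-≥ zero    t       = sym (0∸n≡0 t)
count-≥ (suc n) zero    =
  trans (sum-finList-suc n (λ k → 𝟙 (does (0 ≤? toℕ k)))) (cong suc (count-≥ n zero))
count-≥ (suc n) (suc t) = begin
  sum (map (λ k → 𝟙 (does (suc t ≤? toℕ k))) (finList (suc n)))
    ≡⟨ sum-finList-suc n (λ k → 𝟙 (does (suc t ≤? toℕ k))) ⟩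
  sum (map (λ k → 𝟙 (does (suc t ≤? suc (toℕ k)))) (finList n))
    ≡⟨ cong sum (map-cong (λ k → cong 𝟙 (≤?-suc t (toℕ k))) (finList n)) ⟩
  sum (map (λ k → 𝟙 (does (t ≤? toℕ k))) (finList n))
    ≡⟨ count-≥ n t ⟩
  n ∸ t ∎
  where open ≡-Reasoning

count-≤ : ∀ {n} (k : Fin n) → sum (map (λ j → 𝟙 (does (toℕ j ≤? toℕ k))) (finList n)) ≡ suc (toℕ k)
count-≤ {suc n} zero    =
  trans (sum-finList-suc n (λ j → 𝟙 (does (toℕ j ≤? 0)))) (cong suc (sum-map-zero (finList n)))
count-≤ {suc n} (suc k) = begin
  sum (map (λ j → 𝟙 (does (toℕ j ≤? suc (toℕ k)))) (finList (suc n)))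
    ≡⟨ sum-finList-suc n (λ j → 𝟙 (does (toℕ j ≤? suc (toℕ k)))) ⟩
  1 + sum (map (λ j → 𝟙 (does (suc (toℕ j) ≤? suc (toℕ k)))) (finList n))
    ≡⟨ cong (λ xs → 1 + sum xs) (map-cong (λ j → cong 𝟙 (≤?-suc (toℕ j) (toℕ k))) (finList n)) ⟩
  1 + sum (map (λ j → 𝟙 (does (toℕ j ≤? toℕ k))) (finList n))
    ≡⟨ cong suc (count-≤ k) ⟩
  suc (suc (toℕ k)) ∎
  where open ≡-Reasoning

-- The value of x₁ + ⋯ + x_{k+1} at the point whose only zero coordinate is x_{I+1}.
linFormValue : ℕ → ℕ → ℕ
linFormValue I k = if does (I ≤? k) then k else suc k

linFormValue-suc : ∀ I k → linFormValue (suc I) (suc k) ≡ suc (linFormValue I k)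
linFormValue-suc I k = trans (if-cong (≤?-suc I k)) (sym (if-float suc (does (I ≤? k))))

count-≤-≢ : ∀ {n} (i k : Fin n) →
            sum (map (λ j → 𝟙 (does (toℕ j ≤? toℕ k) ∧ not (does (i ≟F j)))) (finList n))
            ≡ linFormValue (toℕ i) (toℕ k)
count-≤-≢ {suc n} zero    zero    =
  trans (sum-finList-suc n (λ j → 𝟙 (does (toℕ j ≤? 0) ∧ not (does (zero ≟F j))))) (sum-map-zero (finList n))
count-≤-≢ {suc n} (suc i) zero    =
  trans (sum-finList-suc n (λ j → 𝟙 (does (toℕ j ≤? 0) ∧ not (does (suc i ≟F j)))))
        (cong suc (sum-map-zero (finList n)))
count-≤-≢ {suc n} zero    (suc k) = begin
  sum (map (λ j → 𝟙 (does (toℕ j ≤? suc (toℕ k)) ∧ not (does (zero ≟F j)))) (finList (suc n)))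
    ≡⟨ sum-finList-suc n (λ j → 𝟙 (does (toℕ j ≤? suc (toℕ k)) ∧ not (does (zero ≟F j)))) ⟩
  sum (map (λ j → 𝟙 (does (suc (toℕ j) ≤? suc (toℕ k)) ∧ true)) (finList n))
    ≡⟨ cong sum (map-cong (λ j → cong 𝟙 (trans (∧-identityʳ _) (≤?-suc (toℕ j) (toℕ k))))
                          (finList n)) ⟩
  sum (map (λ j → 𝟙 (does (toℕ j ≤? toℕ k))) (finList n))
    ≡⟨ count-≤ k ⟩
  suc (toℕ k) ∎
  where open ≡-Reasoning
count-≤-≢ {suc n} (suc i) (suc k) = begin
  sum (map (λ j → 𝟙 (does (toℕ j ≤? suc (toℕ k)) ∧ not (does (suc i ≟F j)))) (finList (suc n)))
    ≡⟨ sum-finList-suc n (λ j → 𝟙 (does (toℕ j ≤? suc (toℕ k)) ∧ not (does (suc i ≟F j)))) ⟩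
  1 + sum (map (λ j → 𝟙 (does (suc (toℕ j) ≤? suc (toℕ k)) ∧ not (does (i ≟F j)))) (finList n))
    ≡⟨ cong (λ xs → 1 + sum xs)
            (map-cong (λ j → cong (λ b → 𝟙 (b ∧ _)) (≤?-suc (toℕ j) (toℕ k))) (finList n)) ⟩
  1 + sum (map (λ j → 𝟙 (does (toℕ j ≤? toℕ k) ∧ not (does (i ≟F j)))) (finList n))
    ≡⟨ cong suc (count-≤-≢ i k) ⟩
  suc (linFormValue (toℕ i) (toℕ k))
    ≡⟨ linFormValue-suc (toℕ i) (toℕ k) ⟨
  linFormValue (suc (toℕ i)) (suc (toℕ k)) ∎
  where open ≡-Reasoning

product-suc-downFrom : ∀ n → product (map suc (downFrom n)) ≡ n !
product-suc-downFrom zero    = refl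
product-suc-downFrom (suc n) = cong (suc n *_) (product-suc-downFrom n)

product-linFormValue-below : ∀ I n → n ≤ I → product (map (linFormValue I) (downFrom n)) ≡ n !
product-linFormValue-below I zero    _   = refl
product-linFormValue-below I (suc n) n<I =
  cong₂ _*_ (if-cong (dec-false (I ≤? n) (<⇒≱ n<I))) (product-linFormValue-below I n (<⇒≤ n<I))

product-linFormValue-above : ∀ I m → I ≤′ m →
                             product (map (linFormValue I) (downFrom (suc m))) ≡ I * m !
product-linFormValue-above I m ≤′-refl =
  cong₂ _*_ (if-cong (dec-true (I ≤? I) ≤-refl)) (product-linFormValue-below I I ≤-refl)
product-linFormValue-above I (suc m) (≤′-step I≤′m) = begin
  linFormValue I (suc m) * product (map (linFormValue I) (downFrom (suc m)))
    ≡⟨ cong₂ _*_ (if-cong (dec-true (I ≤? suc m) (m≤n⇒m≤1+n (≤′⇒≤ I≤′m))))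
                 (product-linFormValue-above I m I≤′m) ⟩
  suc m * (I * m !)
    ≡⟨ m*[n*o]≡n*[m*o] (suc m) I (m !) ⟩
  I * (suc m * m !) ∎
  where open ≡-Reasoning

module _ {n : ℕ} where

  coeffSum : (Vec ℕ n → Bool) → Poly n → ℕ
  coeffSum b P = sum (map (λ (c , e) → if b e then c else 0) P)

  coeffSum-++ : ∀ b P Q → coeffSum b (P ++ Q) ≡ coeffSum b P + coeffSum b Q
  coeffSum-++ b P Q = trans (cong sum (map-++ _ P Q)) (sum-++ (map _ P) _)

  coeffSum-split : ∀ b P → coeffSum (λ _ → true) P ≡ coeffSum b P + coeffSum (not ∘ b) P
  coeffSum-split b P = trans (cong sum (map-cong split P)) (sum-map-+ _ _ P)
    where
    split : ∀ ((c , e) : ℕ × Vec ℕ n) → c ≡ (if b e then c else 0) + (if not (b e) then c else 0)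
    split (c , e) with b e
    ... | true  = sym (+-identityʳ c)
    ... | false = refl

  module _ (b : Vec ℕ n → Bool) (b-+ : ∀ e f → b (zipWith _+_ e f) ≡ b e ∧ b f) where

    coeffSum-monomial-* : ∀ c e Q → coeffSum b (map (λ (d , f) → c * d , zipWith _+_ e f) Q)
                                   ≡ (if b e then c else 0) * coeffSum b Q
    coeffSum-monomial-* c e Q = begin
      coeffSum b (map (λ (d , f) → c * d , zipWith _+_ e f) Q)
        ≡⟨ cong sum (trans (sym (map-∘ Q)) (map-cong term-* Q)) ⟩
      sum (map (λ (d , f) → (if b e then c else 0) * (if b f then d else 0)) Q)
        ≡⟨ sum-map-*ˡ (if b e then c else 0) _ Q ⟩
      (if b e then c else 0) * coeffSum b Q ∎
      where
      open ≡-Reasoning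
      term-* : ∀ ((d , f) : ℕ × Vec ℕ n) →
               (if b (zipWith _+_ e f) then c * d else 0) ≡ (if b e then c else 0) * (if b f then d else 0)
      term-* (d , f) rewrite b-+ e f with b e | b f
      ... | true  | true  = refl
      ... | true  | false = sym (*-zeroʳ c)
      ... | false | _     = refl

    coeffSum-⊗ : ∀ P Q → coeffSum b (P ⊗ Q) ≡ coeffSum b P * coeffSum b Q
    coeffSum-⊗ []            Q = refl
    coeffSum-⊗ ((c , e) ∷ P) Q = begin
      coeffSum b (cQ ++ P ⊗ Q)                        ≡⟨ coeffSum-++ b cQ (P ⊗ Q) ⟩
      coeffSum b cQ + coeffSum b (P ⊗ Q)              ≡⟨ cong₂ _+_ (coeffSum-monomial-* c e Q) (coeffSum-⊗ P Q) ⟩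
      ce * coeffSum b Q + coeffSum b P * coeffSum b Q ≡⟨ *-distribʳ-+ (coeffSum b Q) ce _ ⟨
      (ce + coeffSum b P) * coeffSum b Q              ∎
      where
      open ≡-Reasoning
      cQ : Poly n
      cQ = map (λ (d , f) → c * d , zipWith _+_ e f) Q
      ce : ℕ
      ce = if b e then c else 0

    coeffSum-foldr-⊗ : b (replicate n 0) ≡ true → (F : A → Poly n) (xs : List A) →
                       coeffSum b (foldr (λ x acc → F x ⊗ acc) one xs) ≡ product (map (coeffSum b ∘ F) xs)
    coeffSum-foldr-⊗ b0 F []       rewrite b0 = refl
    coeffSum-foldr-⊗ b0 F (x ∷ xs) =
      trans (coeffSum-⊗ (F x) _) (cong (coeffSum b (F x) *_) (coeffSum-foldr-⊗ b0 F xs))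

module _ {n : ℕ} where

  unit : Fin n → Vec ℕ n
  unit j = tabulate (λ m → if does (m ≟F j) then 1 else 0)

  coeffSum-linForm : ∀ b (k : Fin n) →
                     coeffSum b (linForm k)
                     ≡ sum (map (λ j → 𝟙 (does (toℕ j ≤? toℕ k) ∧ b (unit j))) (finList n))
  coeffSum-linForm b k = trans (sum-map-concatMap _ _ (finList n)) (cong sum (map-cong term (finList n)))
    where
    term : ∀ j → coeffSum b (if does (toℕ j ≤? toℕ k) then var j else [])
                 ≡ 𝟙 (does (toℕ j ≤? toℕ k) ∧ b (unit j))
    term j with does (toℕ j ≤? toℕ k)
    ... | true  = +-identityʳ _
    ... | false = refl

  coeffSum-ones-linForm : ∀ k → coeffSum (λ _ → true) (linForm k) ≡ suc (toℕ k)
  coeffSum-ones-linForm k = trans (coeffSum-linForm _ k)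
    (trans (cong sum (map-cong (λ j → cong 𝟙 (∧-identityʳ _)) (finList n))) (count-≤ k))

  positiveAt zeroAt : Fin n → Vec ℕ n → Bool
  positiveAt i e = does (0 <? lookup e i)
  zeroAt i = not ∘ positiveAt i

  zeroAt-unit : ∀ i j → zeroAt i (unit j) ≡ not (does (i ≟F j))
  zeroAt-unit i j rewrite lookup∘tabulate (λ m → if does (m ≟F j) then 1 else 0) i with does (i ≟F j)
  ... | true  = refl
  ... | false = refl

  coeffSum-zeroAt-linForm : ∀ i k → coeffSum (zeroAt i) (linForm k) ≡ linFormValue (toℕ i) (toℕ k)
  coeffSum-zeroAt-linForm i k = trans (coeffSum-linForm _ k)
    (trans (cong sum (map-cong (λ j → cong (λ z → 𝟙 (_ ∧ z)) (zeroAt-unit i j)) (finList n))) (count-≤-≢ i k))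

  zeroAt-+ : ∀ i e f → zeroAt i (zipWith _+_ e f) ≡ zeroAt i e ∧ zeroAt i f
  zeroAt-+ i e f rewrite lookup-zipWith _+_ i e f with lookup e i
  ... | zero  = refl
  ... | suc _ = refl

  zeroAt-replicate : ∀ i → zeroAt i (replicate n 0) ≡ true
  zeroAt-replicate i rewrite lookup-replicate i 0 = refl

coeffSum-ones-p : ∀ n → coeffSum (λ _ → true) (p n) ≡ n !
coeffSum-ones-p n = begin
  coeffSum (λ _ → true) (p n)
    ≡⟨ coeffSum-foldr-⊗ (λ _ → true) (λ _ _ → refl) refl linForm (finList n) ⟩
  product (map (coeffSum (λ _ → true) ∘ linForm) (finList n))
    ≡⟨ cong product (map-cong coeffSum-ones-linForm (finList n)) ⟩
  product (map (suc ∘ toℕ) (finList n))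
    ≡⟨ product-finList n suc ⟩
  product (map suc (downFrom n))
    ≡⟨ product-suc-downFrom n ⟩
  n ! ∎
  where open ≡-Reasoning

coeffSum-zeroAt-p : ∀ m (i : Fin (suc m)) → coeffSum (zeroAt i) (p (suc m)) ≡ toℕ i * m !
coeffSum-zeroAt-p m i = begin
  coeffSum (zeroAt i) (p (suc m))
    ≡⟨ coeffSum-foldr-⊗ (zeroAt i) (zeroAt-+ i) (zeroAt-replicate i) linForm (finList (suc m)) ⟩
  product (map (coeffSum (zeroAt i) ∘ linForm) (finList (suc m)))
    ≡⟨ cong product (map-cong (coeffSum-zeroAt-linForm i) (finList (suc m))) ⟩
  product (map (linFormValue (toℕ i) ∘ toℕ) (finList (suc m)))
    ≡⟨ product-finList (suc m) (linFormValue (toℕ i)) ⟩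
  product (map (linFormValue (toℕ i)) (downFrom (suc m)))
    ≡⟨ product-linFormValue-above (toℕ i) m (≤⇒≤′ (toℕ≤pred[n] i)) ⟩
  toℕ i * m ! ∎
  where open ≡-Reasoning

tailSum : ∀ {m} → ℕ → Vec ℕ m → ℕ
tailSum t e = sum (drop t (toList e))

tailSum-[] : ∀ t → tailSum t [] ≡ 0
tailSum-[] zero    = refl
tailSum-[] (suc t) = refl

tailSum-zipWith : ∀ {m} t (e f : Vec ℕ m) → tailSum t (zipWith _+_ e f) ≡ tailSum t e + tailSum t f
tailSum-zipWith t       []      []      =
  trans (tailSum-[] t) (sym (cong₂ _+_ (tailSum-[] t) (tailSum-[] t)))
tailSum-zipWith zero    (x ∷ e) (y ∷ f) =
  trans (cong (x + y +_) (tailSum-zipWith zero e f)) ([m+n]+[o+p]≡[m+o]+[n+p] x y (tailSum 0 e) _)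
tailSum-zipWith (suc t) (x ∷ e) (y ∷ f) = tailSum-zipWith t e f

tailSum-replicate : ∀ m t → tailSum t (replicate m 0) ≡ 0
tailSum-replicate zero    t       = tailSum-[] t
tailSum-replicate (suc m) zero    = tailSum-replicate m zero
tailSum-replicate (suc m) (suc t) = tailSum-replicate m t

tabulate-const : ∀ m {x : ℕ} → tabulate (λ _ → x) ≡ replicate m x
tabulate-const m {x} = trans (tabulate-allFin (λ _ → x)) (map-const (Vec.allFin m) x)

tailSum-unit : ∀ {m} t (j : Fin m) → tailSum t (unit j) ≡ 𝟙 (does (t ≤? toℕ j))
tailSum-unit {suc m} zero    zero    =
  cong suc (trans (cong (tailSum 0) (tabulate-const m)) (tailSum-replicate m 0))
tailSum-unit {suc m} (suc t) zero    = trans (cong (tailSum t) (tabulate-const m)) (tailSum-replicate m t)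
tailSum-unit {suc m} zero    (suc j) = tailSum-unit zero j
tailSum-unit {suc m} (suc t) (suc j) = trans (tailSum-unit t j) (cong 𝟙 (sym (≤?-suc t (toℕ j))))

module _ {n : ℕ} where

  -- tailSum t e = e_{t+1} + ⋯ + e_n; with bound t = n ∸ t these are the conditions defining 𝒜_n.
  TailBounded : (ℕ → ℕ) → Vec ℕ n → Set
  TailBounded bound e = (∀ t → tailSum t e ≤ bound t) × tailSum 0 e ≡ bound 0

  TailBounded-+ : ∀ {c d e f} → TailBounded c e → TailBounded d f →
                  TailBounded (λ t → c t + d t) (zipWith _+_ e f)
  TailBounded-+ {e = e} {f} (e≤c , e≡c) (f≤d , f≡d) =
    (λ t → subst (_≤ _) (sym (tailSum-zipWith t e f)) (+-mono-≤ (e≤c t) (f≤d t))) ,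
    trans (tailSum-zipWith 0 e f) (cong₂ _+_ e≡c f≡d)

  AllExponents : (Vec ℕ n → Set) → Poly n → Set
  AllExponents G P = All (G ∘ proj₂) P

  AllExponents-⊗ : ∀ {G H K : Vec ℕ n → Set} → (∀ {e f} → G e → H f → K (zipWith _+_ e f)) →
                ∀ {P Q} → AllExponents G P → AllExponents H Q → AllExponents K (P ⊗ Q)
  AllExponents-⊗ G+H⇒K GP HQ = concat⁺ (map⁺ (All.map (λ Ge → map⁺ (All.map (G+H⇒K Ge) HQ)) GP))

  𝟙-≤?-mono : ∀ t {j k} → j ≤ k → 𝟙 (does (t ≤? j)) ≤ 𝟙 (does (t ≤? k))
  𝟙-≤?-mono t {j} {k} j≤k = mono (t ≤? j) (t ≤? k)
    where
    mono : (t≤?j : Dec (t ≤ j)) (t≤?k : Dec (t ≤ k)) → 𝟙 (does t≤?j) ≤ 𝟙 (does t≤?k)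
    mono (no  _)   _         = z≤n
    mono (yes _)   (yes _)   = ≤-refl
    mono (yes t≤j) (no  t≰k) = contradiction (≤-trans t≤j j≤k) t≰k

  linForm-exponents : ∀ k → AllExponents (TailBounded (λ t → 𝟙 (does (t ≤? toℕ k)))) (linForm k)
  linForm-exponents k = concat⁺ (map⁺ (All.universal summand (finList n)))
    where
    summand : ∀ j → AllExponents (TailBounded (λ t → 𝟙 (does (t ≤? toℕ k))))
                                 (if does (toℕ j ≤? toℕ k) then var j else [])
    summand j = go (toℕ j ≤? toℕ k)
      where
      go : (j≤?k : Dec (toℕ j ≤ toℕ k)) →
           AllExponents (TailBounded (λ t → 𝟙 (does (t ≤? toℕ k)))) (if does j≤?k then var j else [])
      go (no  _)   = []
      go (yes j≤k) =
        ((λ t → subst (_≤ _) (sym (tailSum-unit t j)) (𝟙-≤?-mono t j≤k)) , tailSum-unit 0 j) ∷ []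

  p-exponents : AllExponents (InA n) (p n)
  p-exponents = All.map toInA (linForms-exponents (finList n))
    where
    count : List (Fin n) → ℕ → ℕ
    count ks t = sum (map (λ k → 𝟙 (does (t ≤? toℕ k))) ks)

    linForms-exponents : ∀ ks →
                         AllExponents (TailBounded (count ks)) (foldr (λ k acc → linForm k ⊗ acc) one ks)
    linForms-exponents []       =
      ((λ t → ≤-reflexive (tailSum-replicate n t)) , tailSum-replicate n 0) ∷ []
    linForms-exponents (k ∷ ks) = AllExponents-⊗ TailBounded-+ (linForm-exponents k) (linForms-exponents ks)

    toInA : ∀ {e} → TailBounded (count (finList n)) e → InA n e
    toInA {e} (bounded , total) =
      All.universal (λ t → subst (tailSum t e ≤_) (count-≥ n t) (bounded t)) _ , trans total (count-≥ n 0)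

coeffTerm : ∀ {m} → Vec ℕ m → ℕ × Vec ℕ m → ℕ
coeffTerm a (c , e) = if does (≡-dec _≟_ e a) then c else 0

sum-map-upTo-≟ : ∀ c {y} n → y < n → sum (map (λ x → if does (y ≟ x) then c else 0) (upTo n)) ≡ c
sum-map-upTo-≟ c {zero}  (suc n) _         =
  trans (sum-map-upTo-suc n (λ x → if does (0 ≟ x) then c else 0))
        (trans (cong (c +_) (sum-map-zero (upTo n))) (+-identityʳ c))
sum-map-upTo-≟ c {suc y} (suc n) (s≤s y<n) =
  trans (sum-map-upTo-suc n (λ x → if does (suc y ≟ x) then c else 0)) (sum-map-upTo-≟ c n y<n)

sum-coeffTerm-boundedVecs : ∀ b m (e : Vec ℕ m) c → sum (toList e) ≤ b →
                            sum (map (λ a → coeffTerm a (c , e)) (boundedVecs b m)) ≡ c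
sum-coeffTerm-boundedVecs b zero    []      c _  = +-identityʳ c
sum-coeffTerm-boundedVecs b (suc m) (y ∷ e) c y+e≤b = begin
  sum (map (λ a → coeffTerm a (c , y ∷ e)) (concatMap (λ x → map (x ∷_) (boundedVecs b m)) (upTo (suc b))))
    ≡⟨ sum-map-concatMap _ (λ x → map (x ∷_) (boundedVecs b m)) (upTo (suc b)) ⟩
  sum (map (λ x → sum (map (λ a → coeffTerm a (c , y ∷ e)) (map (x ∷_) (boundedVecs b m)))) (upTo (suc b)))
    ≡⟨ cong sum (map-cong column (upTo (suc b))) ⟩
  sum (map (λ x → if does (y ≟ x) then c else 0) (upTo (suc b)))
    ≡⟨ sum-map-upTo-≟ c (suc b) (s≤s (m+n≤o⇒m≤o y y+e≤b)) ⟩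
  c ∎
  where
  open ≡-Reasoning
  column : ∀ x → sum (map (λ a → coeffTerm a (c , y ∷ e)) (map (x ∷_) (boundedVecs b m)))
                 ≡ (if does (y ≟ x) then c else 0)
  column x rewrite sym (map-∘ {g = λ a → coeffTerm a (c , y ∷ e)} {f = x ∷_} (boundedVecs b m))
    with does (y ≟ x)
  ... | true  = sum-coeffTerm-boundedVecs b m e c (m+n≤o⇒n≤o y y+e≤b)
  ... | false = sum-map-zero (boundedVecs b m)

sum-coeffTerm-filter : ∀ {m} {P : Vec ℕ m → Set} (P? : Decidable P) L c e →
                       sum (map (λ a → coeffTerm a (c , e)) (filter P? L))
                       ≡ (if does (P? e) then sum (map (λ a → coeffTerm a (c , e)) L) else 0)
sum-coeffTerm-filter P? L c e = begin
  sum (map (λ a → coeffTerm a (c , e)) (filter P? L))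
    ≡⟨ sum-map-filter P? (λ a → coeffTerm a (c , e)) L ⟩
  sum (map (λ a → if does (P? a) then coeffTerm a (c , e) else 0) L)
    ≡⟨ cong sum (map-cong (λ a → only-at-e a (≡-dec _≟_ e a)) L) ⟩
  sum (map (λ a → if does (P? e) then coeffTerm a (c , e) else 0) L)
    ≡⟨ sum-map-if (does (P? e)) (λ a → coeffTerm a (c , e)) L ⟩
  (if does (P? e) then sum (map (λ a → coeffTerm a (c , e)) L) else 0) ∎
  where
  open ≡-Reasoning
  only-at-e : ∀ a (e≟a : Dec (e ≡ a)) → (if does (P? a) then (if does e≟a then c else 0) else 0)
                                       ≡ (if does (P? e) then (if does e≟a then c else 0) else 0)
  only-at-e a (yes refl) = refl
  only-at-e a (no  _)    = trans (if-eta (does (P? a))) (sym (if-eta (does (P? e))))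

sum-coeff-filter-𝒜 : ∀ {n} {Q : Vec ℕ n → Set} (Q? : Decidable Q) (P : Poly n) →
                     AllExponents (InA n) P →
                     sum (map (coeff P) (filter Q? (𝒜 n))) ≡ coeffSum (λ e → does (Q? e)) P
sum-coeff-filter-𝒜 {n} Q? P P⊆𝒜 = begin
  sum (map (coeff P) (filter Q? (𝒜 n)))
    ≡⟨ sum-map-comm coeffTerm (filter Q? (𝒜 n)) P ⟩
  sum (map (λ t → sum (map (λ a → coeffTerm a t) (filter Q? (𝒜 n)))) P)
    ≡⟨ cong sum (map-cong-local (All.map term P⊆𝒜)) ⟩
  coeffSum (λ e → does (Q? e)) P ∎
  where
  open ≡-Reasoning
  term : ∀ {(c , e) : ℕ × Vec ℕ n} → InA n e →
         sum (map (λ a → coeffTerm a (c , e)) (filter Q? (𝒜 n))) ≡ (if does (Q? e) then c else 0)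
  term {c , e} e∈𝒜 = begin
    sum (map (λ a → coeffTerm a (c , e)) (filter Q? (𝒜 n)))
      ≡⟨ sum-coeffTerm-filter Q? (𝒜 n) c e ⟩
    (if does (Q? e) then sum (map (λ a → coeffTerm a (c , e)) (𝒜 n)) else 0)
      ≡⟨ cong (λ s → if does (Q? e) then s else 0) (sum-coeffTerm-filter (InA? n) (boundedVecs n n) c e) ⟩
    (if does (Q? e) then (if does (InA? n e) then sum (map (λ a → coeffTerm a (c , e)) (boundedVecs n n))
                                              else 0)
                    else 0)
      ≡⟨ cong (λ s → if does (Q? e) then s else 0) (if-cong (dec-true (InA? n e) e∈𝒜)) ⟩
    (if does (Q? e) then sum (map (λ a → coeffTerm a (c , e)) (boundedVecs n n)) else 0)
      ≡⟨ cong (λ s → if does (Q? e) then s else 0)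
              (sum-coeffTerm-boundedVecs n n e c (≤-reflexive (proj₂ e∈𝒜))) ⟩
    (if does (Q? e) then c else 0) ∎

lemma7 : (n : ℕ) (i : Fin n) → sumPos n i ≡ (n ∸ toℕ i) * ((n ∸ 1) !)
lemma7 zero    ()
lemma7 (suc m) i = begin
  sumPos (suc m) i                  ≡⟨ sum-coeff-filter-𝒜 (λ a → 0 <? lookup a i) P p-exponents ⟩
  coeffSum (positiveAt i) P         ≡⟨ m+n∸n≡m _ (coeffSum (zeroAt i) P) ⟨
  coeffSum (positiveAt i) P + coeffSum (zeroAt i) P ∸ coeffSum (zeroAt i) P
                                    ≡⟨ cong (_∸ coeffSum (zeroAt i) P) (coeffSum-split (positiveAt i) P) ⟨
  coeffSum (λ _ → true) P ∸ coeffSum (zeroAt i) P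
                                    ≡⟨ cong₂ _∸_ (coeffSum-ones-p (suc m)) (coeffSum-zeroAt-p m i) ⟩
  suc m * m ! ∸ toℕ i * m !         ≡⟨ *-distribʳ-∸ (m !) (suc m) (toℕ i) ⟨
  (suc m ∸ toℕ i) * m !             ∎
  where
  open ≡-Reasoning
  P : Poly (suc m)
  P = p (suc m)
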